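{- Let $k,q\geq 1$. The class $\mathcal{T}^k_q$ is closed under taking minors, closed under taking disjoint unions, and is a subclass of $\mathcal{TW}_{k-1}\cap\mathcal{TD}_q$.
   Context: Graphs are finite, simple, undirected. $\mathcal{TW}_{k}$: graphs of treewidth at most $k$; $\mathcal{TD}_q$: graphs of treedepth at most $q$. A rooted forest is viewed as its ancestor partial order $\preceq$; its height is the size of a longest chain. A $k$-pebble forest cover of $G$ is a rooted forest on $V(G)$ with $p\colon V(G)\to[k]$ such that every edge $uv$ has $u\preceq v$ or $v\preceq u$, and if $uv\in E(G)$ with $u\prec v$ then every $w$ with $u\prec w\preceq v$ has $p(w)\neq p(u)$; its depth is the height of the forest. $\mathcal{T}^k_q$ is the class of graphs admitting a $k$-pebble forest cover of depth at most $q$. -}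

module Defs where

open import Data.Nat using (ℕ; zero; suc; _+_; _≤_)
open import Data.Fin using (Fin; splitAt)
open import Data.Fin.Subset using (Subset; _∈_; _∉_; ∣_∣)
open import Data.Vec using (tabulate)
open import Data.Fin.Subset.Properties using (_∈?_)
open import Relation.Nullary using (does)
open import Data.Bool using (Bool; true; false)
open import Data.Maybe using (Maybe; just; nothing; _>>=_)
open import Data.Sum using (_⊎_; inj₁; inj₂)
open import Data.Product using (Σ; ∃; _×_; _,_)
open import Relation.Binary.PropositionalEquality using (_≡_; _≢_; refl)

record Graph : Set where
  field
    n     : ℕ
    adj   : Fin n → Fin n → Bool
    sym   : ∀ u v → adj u v ≡ adj v u
    irrefl : ∀ v → adj v v ≡ false
open Graph public

V : Graph → Set
V G = Fin (n G)

Edge : (G : Graph) → V G → V G → Set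
Edge G u v = adj G u v ≡ true

data ReachIn {m : ℕ} (R : Fin m → Fin m → Set) (S : Subset m) (a : Fin m) : Fin m → Set where
  here : a ∈ S → ReachIn R S a a
  step : ∀ {b c} → ReachIn R S a b → R b c → c ∈ S → ReachIn R S a c

ConnectedIn : {m : ℕ} → (Fin m → Fin m → Set) → Subset m → Set
ConnectedIn R S = ∀ a b → a ∈ S → b ∈ S → ReachIn R S a b

iterParent : {m : ℕ} → (Fin m → Maybe (Fin m)) → ℕ → Fin m → Maybe (Fin m)
iterParent par zero    v = just v
iterParent par (suc i) v = iterParent par i v >>= par

record Forest (m : ℕ) : Set where
  field
    parent  : Fin m → Maybe (Fin m)
    acyclic : ∀ v → ∃ λ i → iterParent parent i v ≡ nothing
open Forest public

anc : {m : ℕ} → Forest m → ℕ → Fin m → Maybe (Fin m)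
anc F = iterParent (parent F)

_⊢_⪯_ : {m : ℕ} → Forest m → Fin m → Fin m → Set
F ⊢ u ⪯ v = ∃ λ i → anc F i v ≡ just u

_⊢_≺_ : {m : ℕ} → Forest m → Fin m → Fin m → Set
F ⊢ u ≺ v = (F ⊢ u ⪯ v) × (u ≢ v)

-- height (size of a longest chain) is at most q: every root-ward chain
-- v, parent v, ... has at most q elements.
HeightAtMost : {m : ℕ} → ℕ → Forest m → Set
HeightAtMost q F = ∀ v → anc F q v ≡ nothing

record PebbleForestCover (k : ℕ) (G : Graph) : Set where
  field
    forest : Forest (n G)
    pebble : V G → Fin k
    edgesComparable : ∀ u v → Edge G u v → (forest ⊢ u ⪯ v) ⊎ (forest ⊢ v ⪯ u)
    pebbleCond : ∀ u v w → Edge G u v → forest ⊢ u ≺ v →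
                 forest ⊢ u ≺ w → forest ⊢ w ⪯ v → pebble w ≢ pebble u
open PebbleForestCover public

T : ℕ → ℕ → Graph → Set
T k q G = Σ (PebbleForestCover k G) λ C → HeightAtMost q (forest C)

TD : ℕ → Graph → Set
TD q G = Σ (Forest (n G)) λ F → HeightAtMost q F ×
           (∀ u v → Edge G u v → (F ⊢ u ⪯ v) ⊎ (F ⊢ v ⪯ u))

-- Treewidth: tw(G) ≤ w iff G has a tree decomposition with all bags of
-- size ≤ w + 1. The tree is given as a rooted forest with exactly one root.

IsTree : {m : ℕ} → Forest m → Set
IsTree {m} F = ∃ λ (r : Fin m) → parent F r ≡ nothing × (∀ v → parent F v ≡ nothing → v ≡ r)

TreeAdj : {m : ℕ} → Forest m → Fin m → Fin m → Set
TreeAdj F a b = (parent F a ≡ just b) ⊎ (parent F b ≡ just a)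

record TreeDecomposition (w : ℕ) (G : Graph) : Set where
  field
    m      : ℕ
    tree   : Forest m
    isTree : IsTree tree
    bag    : Fin m → Subset (n G)
    vertexCovered : ∀ v → ∃ λ t → v ∈ bag t
    edgeCovered   : ∀ u v → Edge G u v → ∃ λ t → (u ∈ bag t) × (v ∈ bag t)
    connected : ∀ v → ConnectedIn (TreeAdj tree) (tabulate λ t → does (v ∈? bag t))
    width  : ∀ t → ∣ bag t ∣ ≤ suc w

TW : ℕ → Graph → Set
TW w G = TreeDecomposition w G

record MinorModel (H G : Graph) : Set where
  field
    branch    : V H → Subset (n G)
    nonempty  : ∀ x → ∃ λ v → v ∈ branch x
    connected : ∀ x → ConnectedIn (Edge G) (branch x)
    disjoint  : ∀ x y → x ≢ y → ∀ v → v ∈ branch x → v ∉ branch y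
    edges     : ∀ x y → Edge H x y → ∃ λ u → ∃ λ v → u ∈ branch x × v ∈ branch y × Edge G u v

_≼_ : Graph → Graph → Set
H ≼ G = MinorModel H G

⊎adj : {a b : ℕ} → (Fin a → Fin a → Bool) → (Fin b → Fin b → Bool) →
       Fin a ⊎ Fin b → Fin a ⊎ Fin b → Bool
⊎adj f g (inj₁ x) (inj₁ y) = f x y
⊎adj f g (inj₂ x) (inj₂ y) = g x y
⊎adj f g (inj₁ x) (inj₂ y) = false
⊎adj f g (inj₂ x) (inj₁ y) = false

⊎adj-sym : {a b : ℕ} (f : Fin a → Fin a → Bool) (g : Fin b → Fin b → Bool) →
           (∀ u v → f u v ≡ f v u) → (∀ u v → g u v ≡ g v u) →
           ∀ x y → ⊎adj f g x y ≡ ⊎adj f g y x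
⊎adj-sym f g sf sg (inj₁ x) (inj₁ y) = sf x y
⊎adj-sym f g sf sg (inj₂ x) (inj₂ y) = sg x y
⊎adj-sym f g sf sg (inj₁ x) (inj₂ y) = refl
⊎adj-sym f g sf sg (inj₂ x) (inj₁ y) = refl

⊎adj-irr : {a b : ℕ} (f : Fin a → Fin a → Bool) (g : Fin b → Fin b → Bool) →
           (∀ u → f u u ≡ false) → (∀ u → g u u ≡ false) →
           ∀ x → ⊎adj f g x x ≡ false
⊎adj-irr f g if ig (inj₁ x) = if x
⊎adj-irr f g if ig (inj₂ x) = ig x

_⊕_ : Graph → Graph → Graph
G ⊕ H = record
  { n      = n G + n H
  ; adj    = λ u v → ⊎adj (adj G) (adj H) (splitAt (n G) u) (splitAt (n G) v)
  ; sym    = λ u v → ⊎adj-sym (adj G) (adj H) (sym G) (sym H) (splitAt (n G) u) (splitAt (n G) v)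
  ; irrefl = λ v → ⊎adj-irr (adj G) (adj H) (irrefl G) (irrefl H) (splitAt (n G) v)
  }

-- A pebble forest cover of depth q is in particular an elimination forest of height q, which gives
-- the treedepth bound. What a cover needs of its forest F is captured by live sets: u is live at v if
-- u = v, or u is a strict ancestor of v adjacent to a vertex at or below v. The pebbling condition
-- says precisely that pebbles are injective on live sets; conversely, if every live set has at most k
-- elements, pebbles can be assigned greedily from the roots down. So membership in T^k_q means: a
-- forest of height at most q in which edges join comparable vertices and live sets have size at most k.
-- The live sets, hung on the forest below one extra root, form a tree decomposition of width k - 1.
-- Disjoint unions put the two forests side by side. For a minor H of G, order H by the least vertices
-- of the (connected) branch sets; a branch set meeting a live set of H contains an edge entering the
-- subtree of the relevant vertex, which yields an injection of each live set of H into one of G.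

module Submission where

open import Defs hiding (sym)
open import Data.Bool using (true)
open import Data.Bool.Properties using () renaming (_≟_ to _≟ᵇ_)
open import Data.Empty using (⊥; ⊥-elim)
open import Data.Fin using (Fin; zero; suc; punchOut; toℕ; fromℕ<; splitAt; join)
open import Data.Fin.Properties
  using (_≟_; any?; all?; ¬Fin0; punchOut-injective; injective⇒≤; toℕ-fromℕ<; join-splitAt)
  renaming (suc-injective to Fin-suc-injective)
open import Data.Fin.Subset using (Subset; _∈_; ∣_∣)
open import Data.Fin.Subset.Properties using (_∈?_)
open import Data.Maybe using (Maybe; just; nothing; _>>=_; maybe′)
import Data.Maybe.Properties as Maybe
open import Data.Nat using (ℕ; zero; suc; _+_; _∸_; _≤_; _<_; _<?_; z≤n; s≤s)
open import Data.Nat.Properties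
  using ( ≤-refl; ≤-trans; <-≤-trans; ≤-reflexive; <⇒≱; ≤-pred; ≮⇒≥; 1+n≰n; +-suc; m≤n+m; m≤m+n
        ; m∸n+n≡m; ≤-total; +-monoʳ-≤)
open import Data.Product using (∃; ∃₂; _×_; _,_; proj₁; proj₂)
open import Data.Sum as Sum using (_⊎_; inj₁; inj₂)
open import Data.Sum.Relation.Binary.Pointwise as ⊎ᴾ using (Pointwise; ⊎-refl; ⊎-transitive; ⊎-decidable)
open import Data.Unit using (⊤; tt)
open import Data.Vec using (tabulate)
open import Data.Vec.Properties using (lookup∘tabulate; []=⇒lookup; lookup⇒[]=)
open import Data.Vec.Functional using (updateAt)
open import Data.Vec.Functional.Properties using (updateAt-updates; updateAt-minimal)
open import Function using (_∘_)
open import Relation.Binary.PropositionalEquality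
open import Relation.Nullary using (¬_; Dec; yes; no; does; contradiction)
open import Relation.Nullary.Decidable using (dec-true; decidable-stable; _×-dec_; _⊎-dec_; _→-dec_; ¬?)
open import Relation.Unary using (Decidable)

InjectiveOn : {A B : Set} → (A → Set) → (A → B) → Set
InjectiveOn P f = ∀ {x y} → P x → P y → f x ≡ f y → x ≡ y

module _ {n : ℕ} {P : Fin n → Set} (P? : Decidable P) where

  ∈-tabulate⁺ : ∀ {u} → P u → u ∈ tabulate (does ∘ P?)
  ∈-tabulate⁺ {u} pu = lookup⇒[]= u _ (trans (lookup∘tabulate (does ∘ P?) u) (dec-true (P? u) pu))

  ∈-tabulate⁻ : ∀ {u} → u ∈ tabulate (does ∘ P?) → P u
  ∈-tabulate⁻ {u} u∈ with P? u | trans (sym (lookup∘tabulate (does ∘ P?) u)) ([]=⇒lookup u∈)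
  ... | yes pu | _ = pu
  ... | no _   | ()

injection⇒∣tabulate∣≤ : ∀ {n K} {P : Fin n → Set} (P? : Decidable P) (c : ∀ {u} → P u → Fin K) →
                        (∀ {u v} (pu : P u) (pv : P v) → c pu ≡ c pv → u ≡ v) →
                        ∣ tabulate (does ∘ P?) ∣ ≤ K
injection⇒∣tabulate∣≤ {zero} P? c c-inj = z≤n
injection⇒∣tabulate∣≤ {suc n} {K} {P} P? c c-inj with P? zero
... | no _ = injection⇒∣tabulate∣≤ (P? ∘ suc) c λ pu pv → Fin-suc-injective ∘ c-inj pu pv
... | yes p₀ with K
...   | zero = ⊥-elim (¬Fin0 (c p₀))
...   | suc K′ = s≤s (injection⇒∣tabulate∣≤ (P? ∘ suc) c′ c′-inj)
  where
    c₀≢ : ∀ {u} (pu : P (suc u)) → c p₀ ≢ c pu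
    c₀≢ pu eq with () ← c-inj p₀ pu eq

    c′ : ∀ {u} → P (suc u) → Fin K′
    c′ pu = punchOut (c₀≢ pu)

    c′-inj : ∀ {u v} (pu : P (suc u)) (pv : P (suc v)) → c′ pu ≡ c′ pv → u ≡ v
    c′-inj pu pv = Fin-suc-injective ∘ c-inj pu pv ∘ punchOut-injective (c₀≢ pu) (c₀≢ pv)

module _ {m : ℕ} {R : Fin m → Fin m → Set} {S : Subset m} where

  ReachIn-target : ∀ {a b} → ReachIn R S a b → b ∈ S
  ReachIn-target (here b∈S)     = b∈S
  ReachIn-target (step _ _ b∈S) = b∈S

  ReachIn-trans : ∀ {a b c} → ReachIn R S a b → ReachIn R S b c → ReachIn R S a c
  ReachIn-trans a⇝b (here _)            = a⇝b
  ReachIn-trans a⇝b (step b⇝c′ c′c c∈S) = step (ReachIn-trans a⇝b b⇝c′) c′c c∈S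

  ReachIn-sym : (∀ {x y} → R x y → R y x) → ∀ {a b} → ReachIn R S a b → ReachIn R S b a
  ReachIn-sym R-sym (here a∈S)          = here a∈S
  ReachIn-sym R-sym (step a⇝b′ b′b b∈S) =
    ReachIn-trans (step (here b∈S) (R-sym b′b) (ReachIn-target a⇝b′)) (ReachIn-sym R-sym a⇝b′)

  ReachIn-crossing : {P : Fin m → Set} → Decidable P → ∀ {a b} → ReachIn R S a b → ¬ P a → P b →
                     ∃₂ λ x y → x ∈ S × R x y × ¬ P x × P y
  ReachIn-crossing P? (here _)             ¬pa pb = contradiction pb ¬pa
  ReachIn-crossing P? (step {b′} a⇝b′ b′b _) ¬pa pb with P? b′
  ... | yes pb′ = ReachIn-crossing P? a⇝b′ ¬pa pb′
  ... | no ¬pb′ = b′ , _ , ReachIn-target a⇝b′ , b′b , ¬pb′ , pb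

module _ {m : ℕ} (par : Fin m → Maybe (Fin m)) where

  iterParent-suc : ∀ i v → iterParent par (suc i) v ≡ (par v >>= iterParent par i)
  iterParent-suc zero    v with par v
  ... | nothing = refl
  ... | just _  = refl
  iterParent-suc (suc i) v rewrite iterParent-suc i v with par v
  ... | nothing = refl
  ... | just _  = refl

  iterParent-+ : ∀ {i u v} j → iterParent par i v ≡ just u → iterParent par j u ≡ iterParent par (j + i) v
  iterParent-+ zero    vi≡u = sym vi≡u
  iterParent-+ (suc j) vi≡u rewrite iterParent-+ j vi≡u = refl

  iterParent-+-nothing : ∀ {i v} → iterParent par i v ≡ nothing → ∀ j → iterParent par (j + i) v ≡ nothing
  iterParent-+-nothing vi≡∅ zero    = vi≡∅
  iterParent-+-nothing vi≡∅ (suc j) = cong (_>>= par) (iterParent-+-nothing vi≡∅ j)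

module Ancestors {m : ℕ} (F : Forest m) where

  ⪯-refl : ∀ {v} → F ⊢ v ⪯ v
  ⪯-refl = 0 , refl

  ⪯-trans : ∀ {u w v} → F ⊢ u ⪯ w → F ⊢ w ⪯ v → F ⊢ u ⪯ v
  ⪯-trans (i , wi≡u) (j , vj≡w) = i + j , trans (sym (iterParent-+ (parent F) i vj≡w)) wi≡u

  parent⇒⪯ : ∀ {v p} → parent F v ≡ just p → F ⊢ p ⪯ v
  parent⇒⪯ {v} pv≡p = 1 , trans (iterParent-suc (parent F) 0 v) (cong (_>>= just) pv≡p)

  ⪯-linear-below : ∀ {u w v} → F ⊢ u ⪯ v → F ⊢ w ⪯ v → (F ⊢ u ⪯ w) ⊎ (F ⊢ w ⪯ u)
  ⪯-linear-below {u} {w} {v} (i , vi≡u) (j , vj≡w) with ≤-total i j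
  ... | inj₁ i≤j = inj₂ (j ∸ i , trans (iterParent-+ (parent F) (j ∸ i) vi≡u)
                                        (trans (cong (λ l → anc F l v) (m∸n+n≡m i≤j)) vj≡w))
  ... | inj₂ j≤i = inj₁ (i ∸ j , trans (iterParent-+ (parent F) (i ∸ j) vj≡w)
                                        (trans (cong (λ l → anc F l v) (m∸n+n≡m j≤i)) vi≡u))

module BoundedForest {m q : ℕ} (F : Forest m) (height : HeightAtMost q F) where
  open Ancestors F public

  -- The number of strict ancestors, counted with fuel f (enough once f ≥ q).
  depthWithin : ℕ → Fin m → ℕ
  depthWithin zero    v = 0
  depthWithin (suc f) v = maybe′ (suc ∘ depthWithin f) 0 (parent F v)

  private
    above-parent : ∀ f {v p} → anc F (suc f) v ≡ nothing → parent F v ≡ just p → anc F f p ≡ nothing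
    above-parent f {v} v↑≡∅ pv≡p =
      trans (cong (_>>= anc F f) (sym pv≡p)) (trans (sym (iterParent-suc (parent F) f v)) v↑≡∅)

  depthWithin-suc : ∀ f {v} → anc F f v ≡ nothing → depthWithin (suc f) v ≡ depthWithin f v
  depthWithin-suc zero    ()
  depthWithin-suc (suc f) {v} v↑≡∅ with parent F v in pv≡p
  ... | nothing = refl
  ... | just p  = cong suc (depthWithin-suc f (above-parent f v↑≡∅ pv≡p))

  depthWithin-< : ∀ f {v} → anc F f v ≡ nothing → depthWithin f v < f
  depthWithin-< zero    ()
  depthWithin-< (suc f) {v} v↑≡∅ with parent F v in pv≡p
  ... | nothing = s≤s z≤n
  ... | just p  = s≤s (depthWithin-< f (above-parent f v↑≡∅ pv≡p))

  depthWithin-parent : ∀ f {v p} → anc F f v ≡ nothing → parent F v ≡ just p →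
                       depthWithin f v ≡ suc (depthWithin f p)
  depthWithin-parent zero    ()
  depthWithin-parent (suc f) v↑≡∅ pv≡p rewrite pv≡p =
    cong suc (sym (depthWithin-suc f (above-parent f v↑≡∅ pv≡p)))

  depth : Fin m → ℕ
  depth = depthWithin q

  depth<q : ∀ v → depth v < q
  depth<q v = depthWithin-< q (height v)

  depth-parent : ∀ {v p} → parent F v ≡ just p → depth v ≡ suc (depth p)
  depth-parent {v} = depthWithin-parent q (height v)

  depth-parent< : ∀ {v p} → parent F v ≡ just p → depth p < depth v
  depth-parent< pv≡p = ≤-reflexive (sym (depth-parent pv≡p))

  depth-anc : ∀ i {v u} → anc F i v ≡ just u → depth v ≡ i + depth u
  depth-anc zero    refl = refl
  depth-anc (suc i) {v} {u} vi+1≡u with anc F i v in vi≡w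
  ... | nothing = contradiction vi+1≡u λ ()
  ... | just w  = begin
    depth v             ≡⟨ depth-anc i vi≡w ⟩
    i + depth w         ≡⟨ cong (i +_) (depth-parent vi+1≡u) ⟩
    i + suc (depth u)   ≡⟨ +-suc i (depth u) ⟩
    suc i + depth u     ∎
    where open ≡-Reasoning

  ⪯⇒depth≤ : ∀ {u v} → F ⊢ u ⪯ v → depth u ≤ depth v
  ⪯⇒depth≤ {u} (i , vi≡u) = ≤-trans (m≤n+m (depth u) i) (≤-reflexive (sym (depth-anc i vi≡u)))

  ≺⇒depth< : ∀ {u v} → F ⊢ u ≺ v → depth u < depth v
  ≺⇒depth< ((zero  , refl) , u≢v) = contradiction refl u≢v
  ≺⇒depth< {u} ((suc i , vi≡u) , _) =
    ≤-trans (s≤s (m≤n+m (depth u) i)) (≤-reflexive (sym (depth-anc (suc i) vi≡u)))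

  ⪯-antisym : ∀ {u v} → F ⊢ u ⪯ v → F ⊢ v ⪯ u → u ≡ v
  ⪯-antisym {u} {v} u⪯v v⪯u with u ≟ v
  ... | yes u≡v = u≡v
  ... | no  u≢v = contradiction (⪯⇒depth≤ v⪯u) (<⇒≱ (≺⇒depth< (u⪯v , u≢v)))

  ≺-⪯-trans : ∀ {u w v} → F ⊢ u ≺ w → F ⊢ w ⪯ v → F ⊢ u ≺ v
  ≺-⪯-trans (u⪯w , u≢w) w⪯v = ⪯-trans u⪯w w⪯v , λ { refl → u≢w (⪯-antisym u⪯w w⪯v) }

  anc-index<q : ∀ {i v u} → anc F i v ≡ just u → i < q
  anc-index<q {i} {v} vi≡u with i <? q
  ... | yes i<q = i<q
  ... | no  i≮q = contradiction (trans (sym vi≡u) vi≡∅) λ ()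
    where
      vi≡∅ : anc F i v ≡ nothing
      vi≡∅ = subst (λ l → anc F l v ≡ nothing) (m∸n+n≡m (≮⇒≥ i≮q))
                   (iterParent-+-nothing (parent F) (height v) (i ∸ q))

  _⪯?_ : ∀ u v → Dec (F ⊢ u ⪯ v)
  u ⪯? v with any? {P = λ (i : Fin q) → anc F (toℕ i) v ≡ just u}
                   (λ i → Maybe.≡-dec _≟_ (anc F (toℕ i) v) (just u))
  ... | yes (i , vi≡u) = yes (toℕ i , vi≡u)
  ... | no  none       = no λ (i , vi≡u) → none (bounded-index i vi≡u)
    where
      bounded-index : ∀ i → anc F i v ≡ just u → ∃ λ (j : Fin q) → anc F (toℕ j) v ≡ just u
      bounded-index i vi≡u = fromℕ< i<q , subst (λ l → anc F l v ≡ just u) (sym (toℕ-fromℕ< i<q)) vi≡u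
        where i<q = anc-index<q {i} vi≡u

  _≺?_ : ∀ u v → Dec (F ⊢ u ≺ v)
  u ≺? v = (u ⪯? v) ×-dec ¬? (u ≟ v)

  minimal-within : ∀ f (B : Subset m) {v} → depth v < f → v ∈ B →
                   ∃ λ u → u ∈ B × ∀ {w} → w ∈ B → ¬ F ⊢ w ≺ u
  minimal-within (suc f) B {v} v<f+1 v∈B with any? (λ w → (w ∈? B) ×-dec (w ≺? v))
  ... | no  none              = v , v∈B , λ w∈B w≺v → none (_ , w∈B , w≺v)
  ... | yes (w , w∈B , w≺v) = minimal-within f B (<-≤-trans (≺⇒depth< w≺v) (≤-pred v<f+1)) w∈B

  minimal : ∀ (B : Subset m) {v} → v ∈ B → ∃ λ u → u ∈ B × ∀ {w} → w ∈ B → ¬ F ⊢ w ≺ u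
  minimal B {v} = minimal-within (suc (depth v)) B ≤-refl

  ≺-parent : ∀ {u v p} → F ⊢ u ≺ v → parent F v ≡ just p → F ⊢ u ⪯ p
  ≺-parent ((zero  , refl) , u≢v) _ = contradiction refl u≢v
  ≺-parent {v = v} ((suc i , vi+1≡u) , _) pv≡p =
    i , trans (cong (_>>= anc F i) (sym pv≡p)) (trans (sym (iterParent-suc (parent F) i v)) vi+1≡u)

  ≺-root : ∀ {u v} → parent F v ≡ nothing → ¬ F ⊢ u ≺ v
  ≺-root pv≡∅ ((zero  , refl) , u≢v) = u≢v refl
  ≺-root {v = v} pv≡∅ ((suc i , vi+1≡u) , _) =
    contradiction (trans (sym vi+1≡u) (trans (iterParent-suc (parent F) i v) (cong (_>>= anc F i) pv≡∅))) λ ()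

-- A finite tree order of height at most q: down-sets are chains, and the strictly increasing rank
-- bounds their length.
record TreeOrder (A : Set) (q : ℕ) : Set₁ where
  field
    _⊑_            : A → A → Set
    _⊑?_           : ∀ u v → Dec (u ⊑ v)
    rank           : A → ℕ
    rank<          : ∀ v → rank v < q
    ⊑-refl         : ∀ {v} → v ⊑ v
    ⊑-trans        : ∀ {u w v} → u ⊑ w → w ⊑ v → u ⊑ v
    ⊏⇒rank<        : ∀ {u v} → u ⊑ v → u ≢ v → rank u < rank v
    ⊑-linear-below : ∀ {u w v} → u ⊑ v → w ⊑ v → (u ⊑ w) ⊎ (w ⊑ u)

ancestorOrder : ∀ {m q} (F : Forest m) → HeightAtMost q F → TreeOrder (Fin m) q
ancestorOrder {q = q} F height = record
  { _⊑_            = λ u v → F ⊢ u ⪯ v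
  ; _⊑?_           = _⪯?_
  ; rank           = depth
  ; rank<          = depth<q
  ; ⊑-refl         = ⪯-refl
  ; ⊑-trans        = ⪯-trans
  ; ⊏⇒rank<        = λ u⪯v u≢v → ≺⇒depth< (u⪯v , u≢v)
  ; ⊑-linear-below = ⪯-linear-below
  }
  where open BoundedForest {q = q} F height

comap : ∀ {A B q} (f : A → B) → (∀ {x y} → f x ≡ f y → x ≡ y) → TreeOrder B q → TreeOrder A q
comap f f-inj O = record
  { _⊑_            = λ x y → f x ⊑ f y
  ; _⊑?_           = λ x y → f x ⊑? f y
  ; rank           = rank ∘ f
  ; rank<          = rank< ∘ f
  ; ⊑-refl         = ⊑-refl
  ; ⊑-trans        = ⊑-trans
  ; ⊏⇒rank<        = λ fx⊑fy x≢y → ⊏⇒rank< fx⊑fy (x≢y ∘ f-inj)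
  ; ⊑-linear-below = ⊑-linear-below
  }
  where open TreeOrder O

_⊎-treeOrder_ : ∀ {A B q} → TreeOrder A q → TreeOrder B q → TreeOrder (A ⊎ B) q
_⊎-treeOrder_ {A} {B} {q} O₁ O₂ = record
  { _⊑_            = Pointwise O₁._⊑_ O₂._⊑_
  ; _⊑?_           = ⊎-decidable O₁._⊑?_ O₂._⊑?_
  ; rank           = rank
  ; rank<          = λ { (inj₁ a) → O₁.rank< a ; (inj₂ b) → O₂.rank< b }
  ; ⊑-refl         = ⊎-refl O₁.⊑-refl O₂.⊑-refl
  ; ⊑-trans        = ⊎-transitive O₁.⊑-trans O₂.⊑-trans
  ; ⊏⇒rank<        = ⊏⇒rank<
  ; ⊑-linear-below = linear-below
  }
  where
    module O₁ = TreeOrder O₁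
    module O₂ = TreeOrder O₂
    _⊑_ = Pointwise O₁._⊑_ O₂._⊑_

    rank : A ⊎ B → ℕ
    rank = Sum.[ O₁.rank , O₂.rank ]

    ⊏⇒rank< : ∀ {s t} → s ⊑ t → s ≢ t → rank s < rank t
    ⊏⇒rank< (⊎ᴾ.inj₁ a⊑a′) s≢t = O₁.⊏⇒rank< a⊑a′ (s≢t ∘ cong inj₁)
    ⊏⇒rank< (⊎ᴾ.inj₂ b⊑b′) s≢t = O₂.⊏⇒rank< b⊑b′ (s≢t ∘ cong inj₂)

    linear-below : ∀ {s r t} → s ⊑ t → r ⊑ t → (s ⊑ r) ⊎ (r ⊑ s)
    linear-below (⊎ᴾ.inj₁ s⊑t) (⊎ᴾ.inj₁ r⊑t) =
      Sum.map ⊎ᴾ.inj₁ ⊎ᴾ.inj₁ (O₁.⊑-linear-below s⊑t r⊑t)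
    linear-below (⊎ᴾ.inj₂ s⊑t) (⊎ᴾ.inj₂ r⊑t) =
      Sum.map ⊎ᴾ.inj₂ ⊎ᴾ.inj₂ (O₂.⊑-linear-below s⊑t r⊑t)

-- Every finite tree order is the ancestor order of a forest: the parent of v is its largest
-- strict predecessor.
module ForestOf {m q : ℕ} (O : TreeOrder (Fin m) q) where
  open TreeOrder O

  _⊏_ : Fin m → Fin m → Set
  u ⊏ v = u ⊑ v × u ≢ v

  _⊏?_ : ∀ u v → Dec (u ⊏ v)
  u ⊏? v = (u ⊑? v) ×-dec ¬? (u ≟ v)

  IsParent : Fin m → Fin m → Set
  IsParent v p = p ⊏ v × (∀ w → w ⊏ v → w ⊑ p)

  IsParent? : ∀ v p → Dec (IsParent v p)
  IsParent? v p = (p ⊏? v) ×-dec all? (λ w → (w ⊏? v) →-dec (w ⊑? p))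

  parent-exists : ∀ d {v w} → rank v ≤ d + rank w → w ⊏ v → ∃ (IsParent v)
  parent-exists zero    v≤w (w⊑v , w≢v) = contradiction v≤w (<⇒≱ (⊏⇒rank< w⊑v w≢v))
  parent-exists (suc d) {v} {w} v≤d+w w⊏v with any? (λ w′ → (w′ ⊏? v) ×-dec ¬? (w′ ⊑? w))
  ... | no  none =
    w , w⊏v , λ w′ w′⊏v → decidable-stable (w′ ⊑? w) (λ w′⋢w → none (w′ , w′⊏v , w′⋢w))
  ... | yes (w′ , w′⊏v , w′⋢w) with ⊑-linear-below (proj₁ w⊏v) (proj₁ w′⊏v)
  ...   | inj₂ w′⊑w = contradiction w′⊑w w′⋢w
  ...   | inj₁ w⊑w′ = parent-exists d v≤d+w′ w′⊏v
    where
      w<w′ : rank w < rank w′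
      w<w′ = ⊏⇒rank< w⊑w′ λ { refl → w′⋢w ⊑-refl }
      v≤d+w′ : rank v ≤ d + rank w′
      v≤d+w′ = ≤-trans v≤d+w (≤-trans (≤-reflexive (sym (+-suc d (rank w)))) (+-monoʳ-≤ d w<w′))

  parentOf : Fin m → Maybe (Fin m)
  parentOf v with any? (IsParent? v)
  ... | yes (p , _) = just p
  ... | no  _       = nothing

  ParentSpec : Fin m → Maybe (Fin m) → Set
  ParentSpec v (just p) = IsParent v p
  ParentSpec v nothing  = ∀ w → ¬ w ⊏ v

  parentOf-spec : ∀ v → ParentSpec v (parentOf v)
  parentOf-spec v with any? (IsParent? v)
  ... | yes (_ , v-p) = v-p
  ... | no  none      = λ w w⊏v → none (parent-exists (rank v) (m≤m+n (rank v) (rank w)) w⊏v)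

  parentOf-IsParent : ∀ {v p} → parentOf v ≡ just p → IsParent v p
  parentOf-IsParent {v} pv≡p = subst (ParentSpec v) pv≡p (parentOf-spec v)

  parentOf-root : ∀ {v} → parentOf v ≡ nothing → ∀ w → ¬ w ⊏ v
  parentOf-root {v} pv≡∅ = subst (ParentSpec v) pv≡∅ (parentOf-spec v)

  iterParentOf-⊑ : ∀ i {v u} → iterParent parentOf i v ≡ just u → u ⊑ v × i + rank u ≤ rank v
  iterParentOf-⊑ zero    refl = ⊑-refl , ≤-refl
  iterParentOf-⊑ (suc i) {v} {u} vi+1≡u with iterParent parentOf i v in vi≡w
  ... | nothing = contradiction vi+1≡u λ ()
  ... | just w  =
    let (u⊑w , u≢w) , _ = parentOf-IsParent vi+1≡u
        w⊑v , i+w≤v      = iterParentOf-⊑ i vi≡w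
    in ⊑-trans u⊑w w⊑v , ≤-trans (≤-reflexive (sym (+-suc i (rank u))))
                                  (≤-trans (+-monoʳ-≤ i (⊏⇒rank< u⊑w u≢w)) i+w≤v)

  orderForest : Forest m
  orderForest = record { parent = parentOf ; acyclic = λ v → q , height v }
    where
      height : ∀ v → iterParent parentOf q v ≡ nothing
      height v with iterParent parentOf q v in vq≡u
      ... | nothing = refl
      ... | just u  =
        contradiction (≤-trans (m≤m+n q (rank u)) (proj₂ (iterParentOf-⊑ q vq≡u))) (<⇒≱ (rank< v))

  orderForest-height : HeightAtMost q orderForest
  orderForest-height v = proj₂ (Forest.acyclic orderForest v)

  open Ancestors orderForest

  ⪯⇒⊑ : ∀ {u v} → orderForest ⊢ u ⪯ v → u ⊑ v
  ⪯⇒⊑ (i , vi≡u) = proj₁ (iterParentOf-⊑ i vi≡u)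

  ⊑⇒⪯-within : ∀ d {u v} → rank v < d → u ⊑ v → orderForest ⊢ u ⪯ v
  ⊑⇒⪯-within zero    () _
  ⊑⇒⪯-within (suc d) {u} {v} v<d+1 u⊑v with u ≟ v | parentOf v in pv≡p
  ... | yes refl | _       = ⪯-refl
  ... | no  u≢v  | nothing = contradiction (u⊑v , u≢v) (parentOf-root pv≡p u)
  ... | no  u≢v  | just p  =
    let (p⊑v , p≢v) , p-max = parentOf-IsParent pv≡p
    in ⪯-trans (⊑⇒⪯-within d (≤-trans (⊏⇒rank< p⊑v p≢v) (≤-pred v<d+1)) (p-max u (u⊑v , u≢v)))
               (parent⇒⪯ pv≡p)

  ⊑⇒⪯ : ∀ {u v} → u ⊑ v → orderForest ⊢ u ⪯ v
  ⊑⇒⪯ {v = v} = ⊑⇒⪯-within (suc (rank v)) ≤-refl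

parentWithRoot : ∀ {m} → Forest m → Fin (suc m) → Maybe (Fin (suc m))
parentWithRoot F zero    = nothing
parentWithRoot F (suc v) = just (maybe′ suc zero (parent F v))

parentWithRoot-acyclic : ∀ {m} (F : Forest m) i {v} → anc F i v ≡ nothing →
                         iterParent (parentWithRoot F) (suc i) (suc v) ≡ nothing
parentWithRoot-acyclic F zero    ()
parentWithRoot-acyclic F (suc i) {v} vi+1≡∅ rewrite iterParent-suc (parentWithRoot F) (suc i) (suc v)
  with parent F v in pv≡p
... | nothing = iterParent-suc (parentWithRoot F) i zero
... | just p  = parentWithRoot-acyclic F i
  (trans (cong (_>>= anc F i) (sym pv≡p)) (trans (sym (iterParent-suc (parent F) i v)) vi+1≡∅))

withRoot : ∀ {m} → Forest m → Forest (suc m)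
withRoot F = record
  { parent  = parentWithRoot F
  ; acyclic = λ { zero    → 1 , refl
                ; (suc v) → let i , vi≡∅ = acyclic F v in suc i , parentWithRoot-acyclic F i vi≡∅ }
  }

Edge-irrefl : ∀ G {u v} → Edge G u v → u ≢ v
Edge-irrefl G {u} uu refl = contradiction (trans (sym uu) (irrefl G u)) λ ()

Edge-sym : ∀ G {u v} → Edge G u v → Edge G v u
Edge-sym G {u} {v} uv = trans (Graph.sym G v u) uv

EdgesComparable : (G : Graph) → Forest (n G) → Set
EdgesComparable G F = ∀ u v → Edge G u v → (F ⊢ u ⪯ v) ⊎ (F ⊢ v ⪯ u)

-- The vertices whose pebbles must be pairwise distinct at v.
StrictlyLive : (G : Graph) → Forest (n G) → V G → V G → Set
StrictlyLive G F v u = (F ⊢ u ≺ v) × ∃ λ w → Edge G u w × F ⊢ v ⪯ w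

Live : (G : Graph) → Forest (n G) → V G → V G → Set
Live G F v u = (u ≡ v) ⊎ StrictlyLive G F v u

LiveSetsAtMost : ℕ → (G : Graph) → Forest (n G) → Set
LiveSetsAtMost k G F = ∀ v → ∃ λ (c : V G → Fin k) → InjectiveOn (Live G F v) c

module Liveness {q} (G : Graph) (F : Forest (n G)) (height : HeightAtMost q F) where
  open BoundedForest {q = q} F height

  StrictlyLive? : ∀ v u → Dec (StrictlyLive G F v u)
  StrictlyLive? v u = (u ≺? v) ×-dec any? (λ w → (adj G u w ≟ᵇ true) ×-dec (v ⪯? w))

  Live? : ∀ v u → Dec (Live G F v u)
  Live? v u = (u ≟ v) ⊎-dec StrictlyLive? v u

  Live⇒⪯ : ∀ {v u} → Live G F v u → F ⊢ u ⪯ v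
  Live⇒⪯ (inj₁ refl)             = ⪯-refl
  Live⇒⪯ (inj₂ ((u⪯v , _) , _)) = u⪯v

  StrictlyLive-parent : ∀ {v p u} → parent F v ≡ just p → StrictlyLive G F v u → Live G F p u
  StrictlyLive-parent {u = u} pv≡p (u≺v , w , uw , v⪯w) with u ≟ _
  ... | yes u≡p = inj₁ u≡p
  ... | no  u≢p = inj₂ ((≺-parent u≺v pv≡p , u≢p) , w , uw , ⪯-trans (parent⇒⪯ pv≡p) v⪯w)

module LivePebbles {k q} {G : Graph} (C : PebbleForestCover k G) (height : HeightAtMost q (forest C)) where
  open BoundedForest {q = q} (forest C) height
  open Liveness {q = q} G (forest C) height

  pebble-distinct-on-Live : ∀ {v x y} → Live G (forest C) v x → Live G (forest C) v y →
                            forest C ⊢ x ≺ y → pebble C x ≢ pebble C y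
  pebble-distinct-on-Live (inj₁ refl) y-live (x⪯y , x≢y) _ = x≢y (⪯-antisym x⪯y (Live⇒⪯ y-live))
  pebble-distinct-on-Live (inj₂ (x≺v , w , xw , v⪯w)) y-live x≺y x≡y =
    pebbleCond C _ w _ xw (≺-⪯-trans x≺v v⪯w) x≺y (⪯-trans (Live⇒⪯ y-live) v⪯w) (sym x≡y)

  pebble-injectiveOn-Live : ∀ v → InjectiveOn (Live G (forest C) v) (pebble C)
  pebble-injectiveOn-Live v {x} {y} x-live y-live x≡y with x ≟ y
  ... | yes x≡y = x≡y
  ... | no  x≢y with ⪯-linear-below (Live⇒⪯ x-live) (Live⇒⪯ y-live)
  ...   | inj₁ x⪯y = contradiction x≡y (pebble-distinct-on-Live x-live y-live (x⪯y , x≢y))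
  ...   | inj₂ y⪯x = contradiction (sym x≡y) (pebble-distinct-on-Live y-live x-live (y⪯x , x≢y ∘ sym))

-- Walk down the forest keeping a board that says which vertex each pebble currently sits on, and give
-- each vertex a pebble whose current owner is no longer live.
module GreedyPebbling {k q} (G : Graph) (F : Forest (n G)) (height : HeightAtMost q F)
                      (live-bounded : LiveSetsAtMost (suc k) G F) where
  open BoundedForest {q = q} F height
  open Liveness {q = q} G F height

  Board : Set
  Board = Fin (suc k) → Maybe (V G)

  empty : Board
  empty _ = nothing

  Reusable : V G → Maybe (V G) → Set
  Reusable v nothing  = ⊤
  Reusable v (just u) = ¬ StrictlyLive G F v u

  Reusable? : ∀ v x → Dec (Reusable v x)
  Reusable? v nothing  = yes tt
  Reusable? v (just u) = ¬? (StrictlyLive? v u)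

  -- The fallback 0 is never taken (reusable-exists).
  choose : V G → Board → Fin (suc k)
  choose v b with any? (Reusable? v ∘ b)
  ... | yes (c , _) = c
  ... | no  _       = zero

  choose-reusable : ∀ v b → ∃ (Reusable v ∘ b) → Reusable v (b (choose v b))
  choose-reusable v b some with any? (Reusable? v ∘ b)
  ... | yes (_ , reusable) = reusable
  ... | no  none           = contradiction some none

  place : V G → Board → Board
  place v b = updateAt b (choose v b) (λ _ → just v)

  boardWithin : ℕ → V G → Board
  boardWithin zero    v = empty
  boardWithin (suc f) v = place v (maybe′ (boardWithin f) empty (parent F v))

  board : V G → Board
  board = boardWithin q

  boardAbove : V G → Board
  boardAbove v = maybe′ board empty (parent F v)

  pebbleOf : V G → Fin (suc k)
  pebbleOf v = choose v (boardAbove v)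

  boardWithin-suc : ∀ f v → depth v < f → boardWithin (suc f) v ≡ boardWithin f v
  boardWithin-suc (suc f) v v<f+1 with parent F v in pv≡p
  ... | nothing = refl
  ... | just p  = cong (place v) (boardWithin-suc f p (<-≤-trans (depth-parent< pv≡p) (≤-pred v<f+1)))

  boardWithin-unfold : ∀ f v → depth v < f →
                       boardWithin f v ≡ place v (maybe′ (boardWithin f) empty (parent F v))
  boardWithin-unfold (suc f) v v<f+1 with parent F v in pv≡p
  ... | nothing = refl
  ... | just p  = cong (place v) (sym (boardWithin-suc f p (<-≤-trans (depth-parent< pv≡p) (≤-pred v<f+1))))

  board-unfold : ∀ v → board v ≡ place v (boardAbove v)
  board-unfold v = boardWithin-unfold q v (depth<q v)

  board-pebbleOf : ∀ v → board v (pebbleOf v) ≡ just v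
  board-pebbleOf v =
    trans (cong (λ b → b (pebbleOf v)) (board-unfold v)) (updateAt-updates (pebbleOf v) (boardAbove v))

  board-other : ∀ v {c} → c ≢ pebbleOf v → board v c ≡ boardAbove v c
  board-other v {c} c≢pv =
    trans (cong (λ b → b c) (board-unfold v)) (updateAt-minimal c (pebbleOf v) (boardAbove v) c≢pv)

  Faithful : Board → (V G → Set) → Set
  Faithful b P = (∀ c u → b c ≡ just u → pebbleOf u ≡ c) × (∀ u → P u → b (pebbleOf u) ≡ just u)

  boardAbove-faithful : ∀ v → (∀ {p} → parent F v ≡ just p → Faithful (board p) (Live G F p)) →
                        Faithful (boardAbove v) (StrictlyLive G F v)
  boardAbove-faithful v board-p with parent F v in pv≡p
  ... | nothing = (λ _ _ ()) , λ u (u≺v , _) → contradiction u≺v (≺-root pv≡p)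
  ... | just p  = proj₁ (board-p refl) , λ u u-live → proj₂ (board-p refl) u (StrictlyLive-parent pv≡p u-live)

  reusable-exists : ∀ v → Faithful (boardAbove v) (StrictlyLive G F v) → ∃ (Reusable v ∘ boardAbove v)
  reusable-exists v (consistent , _) =
    decidable-stable (any? (Reusable? v ∘ boardAbove v)) λ none →
      1+n≰n (injective⇒≤ (label-injective λ i reusable → none (i , reusable)))
    where
      c = proj₁ (live-bounded v)
      c-inj = proj₂ (live-bounded v)

      occupant : ∀ {i} → ¬ Reusable v (boardAbove v i) →
                 ∃ λ u → boardAbove v i ≡ just u × StrictlyLive G F v u
      occupant {i} ¬reusable with boardAbove v i
      ... | nothing = contradiction tt ¬reusable
      ... | just u  = u , refl , decidable-stable (StrictlyLive? v u) ¬reusable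

      -- If no pebble were reusable, v and the k + 1 occupants would be k + 2 vertices live at v.
      module _ (full : ∀ i → ¬ Reusable v (boardAbove v i)) where
        occupantOf : Fin (suc k) → V G
        occupantOf i = proj₁ (occupant (full i))

        occupantOf-on : ∀ i → boardAbove v i ≡ just (occupantOf i)
        occupantOf-on i = proj₁ (proj₂ (occupant (full i)))

        occupantOf-live : ∀ i → Live G F v (occupantOf i)
        occupantOf-live i = inj₂ (proj₂ (proj₂ (occupant (full i))))

        occupantOf≢v : ∀ i → occupantOf i ≢ v
        occupantOf≢v i = proj₂ (proj₁ (proj₂ (proj₂ (occupant (full i)))))

        label : Fin (suc (suc k)) → Fin (suc k)
        label zero    = c v
        label (suc i) = c (occupantOf i)

        label-injective : ∀ {i j} → label i ≡ label j → i ≡ j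
        label-injective {zero}  {zero}  _ = refl
        label-injective {zero}  {suc j} e =
          contradiction (sym (c-inj (inj₁ refl) (occupantOf-live j) e)) (occupantOf≢v j)
        label-injective {suc i} {zero}  e =
          contradiction (c-inj (occupantOf-live i) (inj₁ refl) e) (occupantOf≢v i)
        label-injective {suc i} {suc j} e = cong suc (begin
          i                          ≡⟨ consistent i _ (occupantOf-on i) ⟨
          pebbleOf (occupantOf i)    ≡⟨ cong pebbleOf (c-inj (occupantOf-live i) (occupantOf-live j) e) ⟩
          pebbleOf (occupantOf j)    ≡⟨ consistent j _ (occupantOf-on j) ⟩
          j                          ∎)
          where open ≡-Reasoning

  board-faithful-step : ∀ v → Faithful (boardAbove v) (StrictlyLive G F v) → Faithful (board v) (Live G F v)
  board-faithful-step v above@(consistent , holds) = consistent′ , holds′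
    where
      fresh : Reusable v (boardAbove v (pebbleOf v))
      fresh = choose-reusable v (boardAbove v) (reusable-exists v above)

      consistent′ : ∀ i u → board v i ≡ just u → pebbleOf u ≡ i
      consistent′ i u vi≡u with i ≟ pebbleOf v
      ... | yes refl = cong pebbleOf (sym (Maybe.just-injective (trans (sym (board-pebbleOf v)) vi≡u)))
      ... | no  i≢pv = consistent i u (trans (sym (board-other v i≢pv)) vi≡u)

      holds′ : ∀ u → Live G F v u → board v (pebbleOf u) ≡ just u
      holds′ u (inj₁ refl)   = board-pebbleOf v
      holds′ u (inj₂ u-live) = trans (board-other v pu≢pv) (holds u u-live)
        where
          pu≢pv : pebbleOf u ≢ pebbleOf v
          pu≢pv pu≡pv = subst (Reusable v) (trans (cong (boardAbove v) (sym pu≡pv)) (holds u u-live)) fresh u-live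

  board-faithful-within : ∀ f v → depth v < f → Faithful (board v) (Live G F v)
  board-faithful-within (suc f) v v<f+1 = board-faithful-step v (boardAbove-faithful v λ pv≡p →
    board-faithful-within f _ (<-≤-trans (depth-parent< pv≡p) (≤-pred v<f+1)))

  pebbleOf-injectiveOn-Live : ∀ v → InjectiveOn (Live G F v) pebbleOf
  pebbleOf-injectiveOn-Live v {x} {y} x-live y-live px≡py = Maybe.just-injective (begin
    just x                ≡⟨ holds x x-live ⟨
    board v (pebbleOf x)  ≡⟨ cong (board v) px≡py ⟩
    board v (pebbleOf y)  ≡⟨ holds y y-live ⟩
    just y                ∎)
    where
      open ≡-Reasoning
      holds = proj₂ (board-faithful-within (suc (depth v)) v ≤-refl)

  cover : EdgesComparable G F → PebbleForestCover (suc k) G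
  cover comparable = record
    { forest          = F
    ; pebble          = pebbleOf
    ; edgesComparable = comparable
    ; pebbleCond      = λ u v w uv _ (u⪯w , u≢w) w⪯v pw≡pu →
        u≢w (sym (pebbleOf-injectiveOn-Live w (inj₁ refl) (inj₂ ((u⪯w , u≢w) , v , uv , w⪯v)) pw≡pu))
    }

LiveSetsAtMost⇒T : ∀ {k q} (G : Graph) (F : Forest (n G)) → HeightAtMost q F → EdgesComparable G F →
                   LiveSetsAtMost (suc k) G F → T (suc k) q G
LiveSetsAtMost⇒T {q = q} G F height comparable bounded =
  GreedyPebbling.cover {q = q} G F height bounded comparable , height

T⇒TD : ∀ {k q} (G : Graph) → T k q G → TD q G
T⇒TD G (C , height) = forest C , height , edgesComparable C

-- The bags are the live sets; the extra root 0 has an empty bag and joins the trees of the forest.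
module TreeDecompositionOfCover {k q} {G : Graph} (C : PebbleForestCover (suc k) G)
                                (height : HeightAtMost q (forest C)) where
  private
    F = forest C
  open BoundedForest {q = q} F height
  open Liveness {q = q} G F height
  open LivePebbles {q = q} C height

  InBag : Fin (suc (n G)) → V G → Set
  InBag zero    _ = ⊥
  InBag (suc t) u = Live G F t u

  InBag? : ∀ t u → Dec (InBag t u)
  InBag? zero    _ = no λ ()
  InBag? (suc t) u = Live? t u

  bag : Fin (suc (n G)) → Subset (n G)
  bag t = tabulate (does ∘ InBag? t)

  Nodes : V G → Subset (suc (n G))
  Nodes v = tabulate λ t → does (v ∈? bag t)

  ∈-Nodes⁺ : ∀ {v t} → Live G F t v → suc t ∈ Nodes v
  ∈-Nodes⁺ {v} t-live = ∈-tabulate⁺ (λ t → v ∈? bag t) (∈-tabulate⁺ (InBag? _) t-live)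

  ∈-Nodes⁻ : ∀ v {t} → t ∈ Nodes v → InBag t v
  ∈-Nodes⁻ v t∈ = ∈-tabulate⁻ (InBag? _) (∈-tabulate⁻ (λ t → v ∈? bag t) t∈)

  Adj = TreeAdj (withRoot F)

  Adj-sym : ∀ {x y} → Adj x y → Adj y x
  Adj-sym = Sum.swap

  reach-from-own-node : ∀ f {v t} → depth t < f → Live G F t v → ReachIn Adj (Nodes v) (suc v) (suc t)
  reach-from-own-node f _ (inj₁ refl) = here (∈-Nodes⁺ (inj₁ refl))
  reach-from-own-node (suc f) {v} {t} t<f+1 t-live@(inj₂ v-live) with parent F t in pt≡p
  ... | nothing = contradiction (proj₁ v-live) (≺-root pt≡p)
  ... | just p  =
    step (reach-from-own-node f (<-≤-trans (depth-parent< pt≡p) (≤-pred t<f+1)) (StrictlyLive-parent pt≡p v-live))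
         (inj₂ (cong (λ x → just (maybe′ suc zero x)) pt≡p))
         (∈-Nodes⁺ t-live)

  Nodes-connected : ∀ v → ConnectedIn Adj (Nodes v)
  Nodes-connected v zero    _ zero∈ _ = ⊥-elim (∈-Nodes⁻ v zero∈)
  Nodes-connected v _ zero    _ zero∈ = ⊥-elim (∈-Nodes⁻ v zero∈)
  Nodes-connected v (suc a) (suc b) a∈ b∈ =
    ReachIn-trans (ReachIn-sym Adj-sym (reach-from-own-node (suc (depth a)) ≤-refl (∈-Nodes⁻ v a∈)))
                  (reach-from-own-node (suc (depth b)) ≤-refl (∈-Nodes⁻ v b∈))

  edge-covered : ∀ u v → Edge G u v → ∃ λ t → u ∈ bag t × v ∈ bag t
  edge-covered u v uv with edgesComparable C u v uv
  ... | inj₁ u⪯v = suc v , ∈-tabulate⁺ (InBag? _) (inj₂ ((u⪯v , Edge-irrefl G uv) , v , uv , ⪯-refl))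
                         , ∈-tabulate⁺ (InBag? _) (inj₁ refl)
  ... | inj₂ v⪯u = suc u , ∈-tabulate⁺ (InBag? _) (inj₁ refl)
                         , ∈-tabulate⁺ (InBag? _) (inj₂ ((v⪯u , Edge-irrefl G vu) , u , vu , ⪯-refl))
    where vu = Edge-sym G uv

  bag-size : ∀ t → ∣ bag t ∣ ≤ suc k
  bag-size zero    = injection⇒∣tabulate∣≤ (InBag? zero) (λ ()) (λ ())
  bag-size (suc t) =
    injection⇒∣tabulate∣≤ (InBag? (suc t)) (λ {u} _ → pebble C u) (pebble-injectiveOn-Live t)

  decomposition : TreeDecomposition k G
  decomposition = record
    { m             = suc (n G)
    ; tree          = withRoot F
    ; isTree        = zero , refl , λ { zero _ → refl ; (suc v) () }
    ; bag           = bag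
    ; vertexCovered = λ v → suc v , ∈-tabulate⁺ (InBag? _) (inj₁ refl)
    ; edgeCovered   = edge-covered
    ; connected     = Nodes-connected
    ; width         = bag-size
    }

T⇒TW : ∀ {k q} (G : Graph) → T (suc k) q G → TW k G
T⇒TW {q = q} G (C , height) = TreeDecompositionOfCover.decomposition {q = q} C height

module DisjointUnion {k q} (G H : Graph)
                     (CG : PebbleForestCover k G) (heightG : HeightAtMost q (forest CG))
                     (CH : PebbleForestCover k H) (heightH : HeightAtMost q (forest CH)) where

  split : V (G ⊕ H) → V G ⊎ V H
  split = splitAt (n G)

  split-injective : ∀ {x y} → split x ≡ split y → x ≡ y
  split-injective {x} {y} x≡y = begin
    x                       ≡⟨ join-splitAt (n G) (n H) x ⟨
    join (n G) (n H) (split x) ≡⟨ cong (join (n G) (n H)) x≡y ⟩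
    join (n G) (n H) (split y) ≡⟨ join-splitAt (n G) (n H) y ⟩
    y                       ∎
    where open ≡-Reasoning

  open ForestOf (comap split split-injective
                   (ancestorOrder {q = q} (forest CG) heightG ⊎-treeOrder ancestorOrder {q = q} (forest CH) heightH))

  _⊑_ : V G ⊎ V H → V G ⊎ V H → Set
  _⊑_ = Pointwise (λ u v → forest CG ⊢ u ⪯ v) (λ u v → forest CH ⊢ u ⪯ v)

  pebble⊎ : V G ⊎ V H → Fin k
  pebble⊎ = Sum.[ pebble CG , pebble CH ]

  comparable⊎ : ∀ s t → ⊎adj (adj G) (adj H) s t ≡ true → (s ⊑ t) ⊎ (t ⊑ s)
  comparable⊎ (inj₁ u) (inj₁ v) uv = Sum.map ⊎ᴾ.inj₁ ⊎ᴾ.inj₁ (edgesComparable CG u v uv)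
  comparable⊎ (inj₂ u) (inj₂ v) uv = Sum.map ⊎ᴾ.inj₂ ⊎ᴾ.inj₂ (edgesComparable CH u v uv)
  comparable⊎ (inj₁ _) (inj₂ _) ()
  comparable⊎ (inj₂ _) (inj₁ _) ()

  pebbleCond⊎ : ∀ {s t r} → ⊎adj (adj G) (adj H) s t ≡ true → s ⊑ t → s ⊑ r → s ≢ r → r ⊑ t →
                pebble⊎ r ≢ pebble⊎ s
  pebbleCond⊎ uv (⊎ᴾ.inj₁ u⪯v) (⊎ᴾ.inj₁ u⪯w) s≢r (⊎ᴾ.inj₁ w⪯v) =
    pebbleCond CG _ _ _ uv (u⪯v , Edge-irrefl G uv) (u⪯w , s≢r ∘ cong inj₁) w⪯v
  pebbleCond⊎ uv (⊎ᴾ.inj₂ u⪯v) (⊎ᴾ.inj₂ u⪯w) s≢r (⊎ᴾ.inj₂ w⪯v) =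
    pebbleCond CH _ _ _ uv (u⪯v , Edge-irrefl H uv) (u⪯w , s≢r ∘ cong inj₂) w⪯v

  cover : PebbleForestCover k (G ⊕ H)
  cover = record
    { forest          = orderForest
    ; pebble          = pebble⊎ ∘ split
    ; edgesComparable = λ u v uv → Sum.map ⊑⇒⪯ ⊑⇒⪯ (comparable⊎ (split u) (split v) uv)
    ; pebbleCond      = λ u v w uv (u⪯v , _) (u⪯w , u≢w) w⪯v →
        pebbleCond⊎ uv (⪯⇒⊑ u⪯v) (⪯⇒⊑ u⪯w) (u≢w ∘ split-injective) (⪯⇒⊑ w⪯v)
    }

  union : T k q (G ⊕ H)
  union = cover , orderForest-height

T-⊕ : ∀ {k q} (G H : Graph) → T k q G → T k q H → T k q (G ⊕ H)
T-⊕ {q = q} G H (CG , heightG) (CH , heightH) = DisjointUnion.union {q = q} G H CG heightG CH heightH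

module ComparableEdges {q} (G : Graph) (F : Forest (n G)) (height : HeightAtMost q F)
                       (comparable : EdgesComparable G F) where
  open BoundedForest {q = q} F height

  minimal⇒below-walk : ∀ {B u} → (∀ {w} → w ∈ B → ¬ F ⊢ w ≺ u) →
                       ∀ {w} → ReachIn (Edge G) B u w → F ⊢ u ⪯ w
  minimal⇒below-walk u-min (here _) = ⪯-refl
  minimal⇒below-walk {u = u} u-min (step {b} {c} u⇝b bc c∈B)
    with minimal⇒below-walk u-min u⇝b | comparable b c bc
  ... | u⪯b | inj₁ b⪯c = ⪯-trans u⪯b b⪯c
  ... | u⪯b | inj₂ c⪯b with ⪯-linear-below u⪯b c⪯b
  ...   | inj₁ u⪯c = u⪯c
  ...   | inj₂ c⪯u with c ≟ u
  ...     | yes refl = ⪯-refl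
  ...     | no  c≢u  = contradiction (c⪯u , c≢u) (u-min c∈B)

  least-of-connected : ∀ {B v} → ConnectedIn (Edge G) B → v ∈ B →
                       ∃ λ r → r ∈ B × ∀ {w} → w ∈ B → F ⊢ r ⪯ w
  least-of-connected {B} B-connected v∈B with minimal B v∈B
  ... | r , r∈B , r-min = r , r∈B , λ w∈B → minimal⇒below-walk r-min (B-connected _ _ r∈B w∈B)

  entering-edge⇒StrictlyLive : ∀ {v a b} → Edge G a b → ¬ F ⊢ v ⪯ a → F ⊢ v ⪯ b → StrictlyLive G F v a
  entering-edge⇒StrictlyLive {a = a} {b} ab v⋠a v⪯b with comparable a b ab
  ... | inj₂ b⪯a = contradiction (⪯-trans v⪯b b⪯a) v⋠a
  ... | inj₁ a⪯b with ⪯-linear-below a⪯b v⪯b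
  ...   | inj₂ v⪯a = contradiction v⪯a v⋠a
  ...   | inj₁ a⪯v = (a⪯v , λ { refl → v⋠a ⪯-refl }) , b , ab , v⪯b

module MinorOfCover {k q} {G H : Graph} (M : H ≼ G) (C : PebbleForestCover (suc k) G)
                    (height : HeightAtMost q (forest C)) where
  private
    F = forest C
  open BoundedForest {q = q} F height
  open Liveness {q = q} G F height
  open LivePebbles {q = q} C height
  open ComparableEdges {q = q} G F height (edgesComparable C)
  open MinorModel M

  private
    least : ∀ x → ∃ λ r → r ∈ branch x × ∀ {w} → w ∈ branch x → F ⊢ r ⪯ w
    least x = least-of-connected (connected x) (proj₂ (nonempty x))

  top : V H → V G
  top x = proj₁ (least x)

  top∈ : ∀ x → top x ∈ branch x
  top∈ x = proj₁ (proj₂ (least x))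

  top⪯ : ∀ x {w} → w ∈ branch x → F ⊢ top x ⪯ w
  top⪯ x = proj₂ (proj₂ (least x))

  branch-unique : ∀ {x y v} → v ∈ branch x → v ∈ branch y → x ≡ y
  branch-unique {x} {y} {v} v∈x v∈y with x ≟ y
  ... | yes x≡y = x≡y
  ... | no  x≢y = contradiction v∈y (disjoint x y x≢y v v∈x)

  top-injective : ∀ {x y} → top x ≡ top y → x ≡ y
  top-injective {x} {y} tx≡ty = branch-unique (top∈ x) (subst (_∈ branch y) (sym tx≡ty) (top∈ y))

  open ForestOf (comap top top-injective (ancestorOrder {q = q} F height))

  comparableH : EdgesComparable H orderForest
  comparableH x y xy with edges x y xy
  ... | u , v , u∈x , v∈y , uv = Sum.map ⊑⇒⪯ ⊑⇒⪯ (tops-comparable (edgesComparable C u v uv))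
    where
      tops-comparable : (F ⊢ u ⪯ v) ⊎ (F ⊢ v ⪯ u) → (F ⊢ top x ⪯ top y) ⊎ (F ⊢ top y ⪯ top x)
      tops-comparable (inj₁ u⪯v) = ⪯-linear-below (⪯-trans (top⪯ x u∈x) u⪯v) (top⪯ y v∈y)
      tops-comparable (inj₂ v⪯u) = ⪯-linear-below (top⪯ x u∈x) (⪯-trans (top⪯ y v∈y) v⪯u)

  live-representative : ∀ {y x} → Live H orderForest y x → ∃ λ a → a ∈ branch x × Live G F (top y) a
  live-representative (inj₁ refl) = top _ , top∈ _ , inj₁ refl
  live-representative {y} {x} (inj₂ ((x⪯y , x≢y) , z , xz , y⪯z)) with edges x z xz
  ... | u , w , u∈x , w∈z , uw with top y ⪯? u
  ...   | no  y⋠u =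
    u , u∈x , inj₂ (entering-edge⇒StrictlyLive uw y⋠u (⪯-trans (⪯⇒⊑ y⪯z) (top⪯ z w∈z)))
  ...   | yes y⪯u with ReachIn-crossing (top y ⪯?_) (connected x (top x) u (top∈ x) u∈x)
                         (λ y⪯x → x≢y (top-injective (⪯-antisym (⪯⇒⊑ x⪯y) y⪯x))) y⪯u
  ...     | a , b , a∈x , ab , y⋠a , y⪯b = a , a∈x , inj₂ (entering-edge⇒StrictlyLive ab y⋠a y⪯b)

  -- Outside Live H orderForest y the value is irrelevant; top x is a placeholder.
  representative : V H → V H → V G
  representative y x with any? (λ a → (a ∈? branch x) ×-dec Live? (top y) a)
  ... | yes (a , _) = a
  ... | no  _       = top x

  representative-spec : ∀ {y x} → Live H orderForest y x →
                        representative y x ∈ branch x × Live G F (top y) (representative y x)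
  representative-spec {y} {x} x-live with any? (λ a → (a ∈? branch x) ×-dec Live? (top y) a)
  ... | yes (_ , spec) = spec
  ... | no  none       = contradiction (live-representative x-live) none

  live-setsH : LiveSetsAtMost (suc k) H orderForest
  live-setsH y = pebble C ∘ representative y , λ x-live x′-live same →
    let a∈x , a-live = representative-spec x-live
        a′∈x′ , a′-live = representative-spec x′-live
        a≡a′ = pebble-injectiveOn-Live (top y) a-live a′-live same
    in branch-unique a∈x (subst (_∈ branch _) (sym a≡a′) a′∈x′)

  minor : T (suc k) q H
  minor = LiveSetsAtMost⇒T {q = q} H orderForest orderForest-height comparableH live-setsH

T-minor-closed : ∀ {k q} (G H : Graph) → H ≼ G → T (suc k) q G → T (suc k) q H
T-minor-closed {q = q} G H M (C , height) = MinorOfCover.minor {q = q} M C height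

corollary15 : ∀ (k q : ℕ) → 1 ≤ k → 1 ≤ q →
    (∀ (G H : Graph) → H ≼ G → T k q G → T k q H)
    × (∀ (G H : Graph) → T k q G → T k q H → T k q (G ⊕ H))
    × (∀ (G : Graph) → T k q G → TW (k ∸ 1) G × TD q G)
corollary15 zero    q ()
corollary15 (suc k) q _ _ =
  T-minor-closed {q = q} , T-⊕ {q = q} , λ G C → T⇒TW {q = q} G C , T⇒TD {q = q} G C
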